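{- Let $\rho\ge1$, $d=(\rho+2)k+1$, and let $(D,T,k)$ be a YES-instance of SFAST with a regular order $\sigma=(v_1,\dots,v_n)$ of $V(D)$ satisfying $\mathrm{cost}(\sigma)\le\rho k$. Let $I=[v_l,v_r]$ be a maximal non-terminal interval w.r.t. $\sigma$ with $|I|\ge 2d+1$ containing at least $k+1$ rich vertices, and $I_L=[v_1,v_{l-1}]$, $I_R=[v_{r+1},v_n]$. Then for every optimal order $\sigma^*=(\sigma^*_1,\dots,\sigma^*_n)$ there is a maximal non-terminal interval $I^*=[\sigma^*_{l'},\sigma^*_{r'}]$ w.r.t. $\sigma^*$, with $I^*_L=[\sigma^*_1,\sigma^*_{l'-1}]$ and $I^*_R=[\sigma^*_{r'+1},\sigma^*_n]$, such that: (a) $T\cap I_L\subseteq I^*_L$ and $T\cap I_R\subseteq I^*_R$; (b) every rich vertex of $I$ belongs to $I^*$; (c) no out-rich vertex of $I$ belongs to $I^*_R$ and no in-rich vertex of $I$ belongs to $I^*_L$; (d) $I_L\cap I^*_R=\emptyset$ and $I_R\cap I^*_L=\emptyset$.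
   Context: SFAST instance $(D,T,k)$: $D$ a tournament, $T\subseteq V(D)$; YES-instance if some $S\subseteq A(D)$, $|S|\le k$, makes $D-S$ free of directed cycles through vertices of $T$. For an order $\sigma=(v_1,\dots,v_n)$: interval $[v_a,v_b]=\{v_m:a\le m\le b\}$, length $b-a+1$; non-terminal interval: contains no vertex of $T$; maximal: not a proper subinterval of another non-terminal interval. An arc $v_av_b$ is backward if $b<a$, its span is $[v_b,v_a]$ and it is above each vertex of its span; affected if above some terminal; $\mathrm{cost}(\sigma)$ = number of affected arcs. An optimal order is one of minimum cost. $\sigma$ is regular if for every non-terminal interval $I=[v_a,v_b]$, $|N^+_I(v_a)|\ge\lceil(b-a)/2\rceil$ and $|N^-_I(v_b)|\ge\lceil(b-a)/2\rceil$ ($N^\pm_X$: out-/in-neighbours within $X$). For a non-terminal $v$ in a maximal non-terminal interval $I$ w.r.t. $\sigma$: in-rich if $|N^+_I(v)|\le d-1$; out-rich if $|N^-_I(v)|\le d-1$; rich if $|N^+_I(v)|\ge d$ and $|N^-_I(v)|\ge d$. -}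

module Defs where

open import Data.Nat using (ℕ; zero; suc; _+_; _*_; _∸_; _≤_; _<_; _≤ᵇ_; _<ᵇ_; ⌈_/2⌉)
open import Data.Bool using (Bool; true; false; not; _∧_; _∨_; if_then_else_)
open import Data.Fin using (Fin; zero; suc; toℕ; inject₁; fromℕ)
open import Data.Fin.Permutation using (Permutation′; _⟨$⟩ʳ_; _⟨$⟩ˡ_)
open import Data.Product using (Σ; ∃; _×_; _,_)
open import Relation.Binary.PropositionalEquality using (_≡_)
open import Relation.Nullary using (¬_)

count : ∀ {n} → (Fin n → Bool) → ℕ
count {zero}  f = 0
count {suc n} f = (if f zero then 1 else 0) + count (λ i → f (suc i))

sumF : ∀ {n} → (Fin n → ℕ) → ℕ
sumF {zero}  f = 0
sumF {suc n} f = f zero + sumF (λ i → f (suc i))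

count₂ : ∀ {n} → (Fin n → Fin n → Bool) → ℕ
count₂ f = sumF (λ u → count (f u))

anyF : ∀ {n} → (Fin n → Bool) → Bool
anyF {zero}  f = false
anyF {suc n} f = f zero ∨ anyF (λ i → f (suc i))

record Tournament (n : ℕ) : Set where
  field
    arc    : Fin n → Fin n → Bool
    irrefl : ∀ u → arc u u ≡ false
    tourn  : ∀ u v → ¬ (u ≡ v) → arc u v ≡ not (arc v u)

open Tournament public

record DirCycle {n : ℕ} (E : Fin n → Fin n → Bool) : Set where
  field
    len   : ℕ
    vtx   : Fin (suc len) → Fin n
    inj   : ∀ i j → vtx i ≡ vtx j → i ≡ j
    step  : ∀ (i : Fin len) → E (vtx (inject₁ i)) (vtx (suc i)) ≡ true
    close : E (vtx (fromℕ len)) (vtx zero) ≡ true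

open DirCycle public

-- (D, T, k) is a YES-instance of SFAST: some arc set S ⊆ A(D) with |S| ≤ k
-- such that D - S has no directed cycle through a vertex of T.
YesInstance : ∀ {n} → Tournament n → (Fin n → Bool) → ℕ → Set
YesInstance {n} D term k =
  Σ (Fin n → Fin n → Bool) λ S →
    (∀ u v → S u v ≡ true → arc D u v ≡ true) ×
    count₂ S ≤ k ×
    (∀ (C : DirCycle (λ u v → arc D u v ∧ not (S u v))) (i : Fin (suc (len C))) →
       term (vtx C i) ≡ false)

-- Orders: σ ⟨$⟩ʳ p is the vertex at position p (positions 0 … n-1),
-- pos σ v is the position of v.

Order : ℕ → Set
Order n = Permutation′ n

pos : ∀ {n} → Order n → Fin n → ℕ
pos σ v = toℕ (σ ⟨$⟩ˡ v)

inIᵇ : ∀ {n} → Order n → Fin n → Fin n → Fin n → Bool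
inIᵇ σ a b v = (toℕ a ≤ᵇ pos σ v) ∧ (pos σ v ≤ᵇ toℕ b)

InI : ∀ {n} → Order n → Fin n → Fin n → Fin n → Set
InI σ a b v = toℕ a ≤ pos σ v × pos σ v ≤ toℕ b

affectedᵇ : ∀ {n} → Tournament n → (Fin n → Bool) → Order n → Fin n → Fin n → Bool
affectedᵇ D term σ u v =
  arc D u v ∧ (pos σ v <ᵇ pos σ u) ∧
  anyF (λ t → term t ∧ (pos σ v ≤ᵇ pos σ t) ∧ (pos σ t ≤ᵇ pos σ u))

cost : ∀ {n} → Tournament n → (Fin n → Bool) → Order n → ℕ
cost D term σ = count₂ (affectedᵇ D term σ)

Optimal : ∀ {n} → Tournament n → (Fin n → Bool) → Order n → Set
Optimal D term σ = ∀ τ → cost D term σ ≤ cost D term τ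

NonTermInterval : ∀ {n} → (Fin n → Bool) → Order n → Fin n → Fin n → Set
NonTermInterval term σ a b =
  toℕ a ≤ toℕ b × (∀ v → term v ≡ true → ¬ InI σ a b v)

MaximalNT : ∀ {n} → (Fin n → Bool) → Order n → Fin n → Fin n → Set
MaximalNT term σ a b =
  NonTermInterval term σ a b ×
  (∀ a' b' → NonTermInterval term σ a' b' → toℕ a' ≤ toℕ a → toℕ b ≤ toℕ b' →
     a' ≡ a × b' ≡ b)

outI : ∀ {n} → Tournament n → Order n → Fin n → Fin n → Fin n → ℕ
outI D σ a b v = count (λ w → arc D v w ∧ inIᵇ σ a b w)

inNI : ∀ {n} → Tournament n → Order n → Fin n → Fin n → Fin n → ℕ
inNI D σ a b v = count (λ w → arc D w v ∧ inIᵇ σ a b w)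

Regular : ∀ {n} → Tournament n → (Fin n → Bool) → Order n → Set
Regular D term σ =
  ∀ a b → NonTermInterval term σ a b →
    ⌈ (toℕ b ∸ toℕ a) /2⌉ ≤ outI D σ a b (σ ⟨$⟩ʳ a) ×
    ⌈ (toℕ b ∸ toℕ a) /2⌉ ≤ inNI D σ a b (σ ⟨$⟩ʳ b)

InRich OutRich Rich : ∀ {n} → Tournament n → Order n → ℕ → Fin n → Fin n → Fin n → Set
InRich  D σ d a b v = outI D σ a b v ≤ d ∸ 1
OutRich D σ d a b v = inNI D σ a b v ≤ d ∸ 1
Rich    D σ d a b v = d ≤ outI D σ a b v × d ≤ inNI D σ a b v

richᵇ : ∀ {n} → Tournament n → Order n → ℕ → Fin n → Fin n → Fin n → Bool
richᵇ D σ d a b v = (d ≤ᵇ outI D σ a b v) ∧ (d ≤ᵇ inNI D σ a b v)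

richCount : ∀ {n} → Tournament n → Order n → ℕ → Fin n → Fin n → ℕ
richCount D σ d a b = count (λ v → inIᵇ σ a b v ∧ richᵇ D σ d a b v)

{-# OPTIONS --safe #-}
-- Charge arcs to the terminals they span.  A YES-instance has an order of cost at most k (sort
-- the vertices by the number of terminals reaching them in D - S), so cost σ + 2 cost σ* < d for
-- an optimal σ*.  If σ* puts a vertex v before a terminal t that lies left of I in σ, then every
-- in-neighbour w of v in I yields an affected arc: w → t in σ, or t → w or w → v in σ*; so v has
-- fewer than d in-neighbours in I.  Symmetrically on the right.  A vertex left of I is separated
-- from I by a terminal of σ, so it has at most cost σ in-neighbours in I; placed after a terminal
-- right of I it would also have fewer than d out-neighbours there, contradicting |I| ≥ 2d + 1.
-- Take for I* the maximal non-terminal interval of σ* around a rich vertex of I: the terminals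
-- bounding I* then come from the correct side of I, which gives (a)-(d).
module Submission where

open import Defs
open import Data.Nat
  using (ℕ; zero; suc; pred; _+_; _*_; _∸_; _≤_; _<_; _>_; _≤′_; _≤ᵇ_; _<ᵇ_; _<?_;
         z≤n; s≤s; s≤s⁻¹; ≤′-refl; ≤′-step; >-nonZero)
open import Data.Nat.Properties
open import Data.Fin using (Fin; zero; suc; toℕ; fromℕ; fromℕ<; inject₁; punchOut)
open import Data.Fin.Properties
  using (toℕ-injective; toℕ<n; toℕ-fromℕ<; toℕ≤pred[n]; any?; punchOut-injective; injective⇒≤;
         fromℕ≢inject₁)
  renaming (_≟_ to _≟ᶠ_)
import Data.Fin.Properties as Finₚ
open import Data.Fin.Permutation using (_⟨$⟩ʳ_; _⟨$⟩ˡ_; permutation; inverseˡ; inverseʳ)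
open import Data.Bool using (Bool; true; false; not; _∧_; _∨_; if_then_else_)
open import Data.Bool.Properties using (T-≡; ¬-not; not-¬; ∧-zeroʳ) renaming (_≟_ to _≟ᵇ_)
open import Data.Empty using (⊥; ⊥-elim)
open import Data.List using (tabulate)
open import Data.List.Extrema.Nat
  using (max; min; max≤v⁺; v≤max⁺; v≤min⁺; min≤v⁺; min≤⊤; argmax-sel; argmin-sel)
import Data.List.Relation.Unary.All.Properties as All
import Data.List.Relation.Unary.Any.Properties as Any
open import Data.List.Membership.Propositional.Properties using (∈-tabulate⁻)
open import Data.Product using (Σ; ∃; _×_; _,_; proj₁; proj₂)
open import Data.Sum using (_⊎_; inj₁; inj₂)
import Data.Sum as Sum
open import Function using (_∘_; Injective)
open import Function.Bundles using (Equivalence)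
open import Relation.Binary.Definitions using (tri<; tri≈; tri>)
open import Relation.Binary.PropositionalEquality
open import Relation.Nullary using (¬_; yes; no; does; contradiction)
open import Relation.Nullary.Decidable using (dec-true; dec-false; _×-dec_)

∧-intro : ∀ {a b} → a ≡ true → b ≡ true → a ∧ b ≡ true
∧-intro refl refl = refl

∧-elim : ∀ {a b} → a ∧ b ≡ true → a ≡ true × b ≡ true
∧-elim {true} b = refl , b

∨-intro : ∀ {a b} → a ≡ true ⊎ b ≡ true → a ∨ b ≡ true
∨-intro {true}  _        = refl
∨-intro {false} (inj₁ ())
∨-intro {false} (inj₂ b) = b

∨-elim : ∀ {a b} → a ∨ b ≡ true → a ≡ true ⊎ b ≡ true
∨-elim {true}  _ = inj₁ refl
∨-elim {false} b = inj₂ b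

≤ᵇ-intro : ∀ {m n} → m ≤ n → (m ≤ᵇ n) ≡ true
≤ᵇ-intro = Equivalence.to T-≡ ∘ ≤⇒≤ᵇ

≤ᵇ-elim : ∀ {m n} → (m ≤ᵇ n) ≡ true → m ≤ n
≤ᵇ-elim = ≤ᵇ⇒≤ _ _ ∘ Equivalence.from T-≡

<ᵇ-intro : ∀ {m n} → m < n → (m <ᵇ n) ≡ true
<ᵇ-intro = Equivalence.to T-≡ ∘ <⇒<ᵇ

<ᵇ-elim : ∀ {m n} → (m <ᵇ n) ≡ true → m < n
<ᵇ-elim = <ᵇ⇒< _ _ ∘ Equivalence.from T-≡

<ᵇ-irrefl : ∀ m → (m <ᵇ m) ≢ true
<ᵇ-irrefl m = <-irrefl refl ∘ <ᵇ-elim {m}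

≟ᶠ-elim : ∀ {n} {x y : Fin n} → does (x ≟ᶠ y) ≡ true → x ≡ y
≟ᶠ-elim {x = x} {y} eq with x ≟ᶠ y
... | yes x≡y = x≡y

anyF-intro : ∀ {n} (f : Fin n → Bool) x → f x ≡ true → anyF f ≡ true
anyF-intro f zero    fx = ∨-intro (inj₁ fx)
anyF-intro f (suc x) fx = ∨-intro (inj₂ (anyF-intro (f ∘ suc) x fx))

anyF-elim : ∀ {n} (f : Fin n → Bool) → anyF f ≡ true → ∃ λ x → f x ≡ true
anyF-elim {suc n} f any with ∨-elim {f zero} any
... | inj₁ f0   = zero , f0
... | inj₂ rest = let x , fx = anyF-elim (f ∘ suc) rest in suc x , fx

𝟙 : Bool → ℕ
𝟙 b = if b then 1 else 0

𝟙≤1 : ∀ b → 𝟙 b ≤ 1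
𝟙≤1 true  = ≤-refl
𝟙≤1 false = z≤n

𝟙-mono : ∀ {a b} → (a ≡ true → b ≡ true) → 𝟙 a ≤ 𝟙 b
𝟙-mono {false} _   = z≤n
𝟙-mono {true}  a⇒b rewrite a⇒b refl = ≤-refl

count≤n : ∀ {n} (f : Fin n → Bool) → count f ≤ n
count≤n {zero}  f = z≤n
count≤n {suc n} f = +-mono-≤ (𝟙≤1 (f zero)) (count≤n (f ∘ suc))

count-mono : ∀ {n} {f g : Fin n → Bool} → (∀ x → f x ≡ true → g x ≡ true) → count f ≤ count g
count-mono {zero}  _   = z≤n
count-mono {suc n} f⊆g = +-mono-≤ (𝟙-mono (f⊆g zero)) (count-mono (f⊆g ∘ suc))

count-< : ∀ {n} {f g : Fin n → Bool} x →
          (∀ y → f y ≡ true → g y ≡ true) → f x ≢ true → g x ≡ true → count f < count g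
count-< {f = f} zero f⊆g fx gx rewrite ¬-not fx | gx = s≤s (count-mono (f⊆g ∘ suc))
count-< (suc x) f⊆g fx gx = +-mono-≤-< (𝟙-mono (f⊆g zero)) (count-< x (f⊆g ∘ suc) fx gx)

count-∨ : ∀ {n} (f g : Fin n → Bool) → count (λ x → f x ∨ g x) ≤ count f + count g
count-∨ {zero}  f g = z≤n
count-∨ {suc n} f g with f zero | g zero
... | true  | _     = s≤s (≤-trans (count-∨ (f ∘ suc) (g ∘ suc)) (+-monoʳ-≤ (count (f ∘ suc)) (m≤n+m _ _)))
... | false | true  = ≤-trans (s≤s (count-∨ (f ∘ suc) (g ∘ suc))) (≤-reflexive (sym (+-suc _ _)))
... | false | false = count-∨ (f ∘ suc) (g ∘ suc)

count-cover₃ : ∀ {n} {f g h i : Fin n → Bool} →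
               (∀ x → f x ≡ true → g x ≡ true ⊎ h x ≡ true ⊎ i x ≡ true) →
               count f ≤ count g + (count h + count i)
count-cover₃ {f = f} {g} {h} {i} cover = begin
  count f                                   ≤⟨ count-mono (λ x → ∨-intro ∘ Sum.map₂ ∨-intro ∘ cover x) ⟩
  count (λ x → g x ∨ (h x ∨ i x))           ≤⟨ count-∨ g _ ⟩
  count g + count (λ x → h x ∨ i x)         ≤⟨ +-monoʳ-≤ (count g) (count-∨ h i) ⟩
  count g + (count h + count i)             ∎
  where open ≤-Reasoning

count-except : ∀ {n} {f g : Fin n → Bool} x →
               (∀ y → f y ≡ true → y ≢ x → g y ≡ true) → count f ≤ suc (count g)
count-except {f = f} zero f⊆g =
  ≤-trans (+-mono-≤ (𝟙≤1 (f zero)) (count-mono (λ y fy → f⊆g (suc y) fy λ ()))) (s≤s (m≤n+m _ _))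
count-except (suc x) f⊆g =
  ≤-trans (+-mono-≤ (𝟙-mono (λ f0 → f⊆g zero f0 λ ()))
                    (count-except x (λ y fy y≢x → f⊆g (suc y) fy (y≢x ∘ Finₚ.suc-injective))))
          (≤-reflexive (+-suc _ _))

witness⇒count-pos : ∀ {n} {f : Fin n → Bool} x → f x ≡ true → 0 < count f
witness⇒count-pos {f = f} zero fx rewrite fx = s≤s z≤n
witness⇒count-pos (suc x) fx = ≤-trans (witness⇒count-pos x fx) (m≤n+m _ _)

count-pos⇒witness : ∀ {n} (f : Fin n → Bool) → 0 < count f → ∃ λ x → f x ≡ true
count-pos⇒witness {suc n} f pos with f zero in f0
... | true  = zero , f0
... | false = let x , fx = count-pos⇒witness (f ∘ suc) pos in suc x , fx

count-injection : ∀ {m n} (f : Fin n → Bool) (h : Fin m → Fin n) →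
                  Injective _≡_ _≡_ h → (∀ i → f (h i) ≡ true) → m ≤ count f
count-injection {zero}  f h h-inj fh = z≤n
count-injection {suc m} f h h-inj fh =
  ≤-<-trans (count-injection f′ (h ∘ inject₁) (Finₚ.inject₁-injective ∘ h-inj) f′∘h)
            (count-< last (λ y → proj₁ ∘ ∧-elim) (not-¬ f′-last) (fh (fromℕ m)))
  where
  last : Fin _
  last = h (fromℕ m)
  f′ : Fin _ → Bool
  f′ y = f y ∧ not (does (y ≟ᶠ last))
  f′∘h : ∀ i → f′ (h (inject₁ i)) ≡ true
  f′∘h i = ∧-intro (fh (inject₁ i)) (cong not (dec-false (_ ≟ᶠ last) (fromℕ≢inject₁ ∘ sym ∘ h-inj)))
  f′-last : f′ last ≡ false
  f′-last rewrite dec-true (last ≟ᶠ last) refl = ∧-zeroʳ (f last)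

sumF-mono : ∀ {n} {f g : Fin n → ℕ} → (∀ x → f x ≤ g x) → sumF f ≤ sumF g
sumF-mono {zero}  _   = z≤n
sumF-mono {suc n} f≤g = +-mono-≤ (f≤g zero) (sumF-mono (f≤g ∘ suc))

term≤sumF : ∀ {n} (f : Fin n → ℕ) x → f x ≤ sumF f
term≤sumF f zero    = m≤m+n _ _
term≤sumF f (suc x) = ≤-trans (term≤sumF (f ∘ suc) x) (m≤n+m _ _)

count≤sumF : ∀ {n} {f : Fin n → Bool} {g : Fin n → ℕ} → (∀ x → f x ≡ true → 0 < g x) → count f ≤ sumF g
count≤sumF {zero}              _   = z≤n
count≤sumF {suc n} {f} {g} pos = +-mono-≤ head (count≤sumF (pos ∘ suc))
  where
  head : 𝟙 (f zero) ≤ g zero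
  head with f zero in f0
  ... | true  = pos zero f0
  ... | false = z≤n

row≤count₂ : ∀ {n} (f : Fin n → Fin n → Bool) u → count (f u) ≤ count₂ f
row≤count₂ f = term≤sumF (count ∘ f)

col≤count₂ : ∀ {n} (f : Fin n → Fin n → Bool) v → count (λ u → f u v) ≤ count₂ f
col≤count₂ f v = count≤sumF {f = λ u → f u v} (λ u → witness⇒count-pos v)

count₂-mono : ∀ {n} {f g : Fin n → Fin n → Bool} →
              (∀ u v → f u v ≡ true → g u v ≡ true) → count₂ f ≤ count₂ g
count₂-mono f⊆g = sumF-mono (λ u → count-mono (f⊆g u))

injective⇒surjective : ∀ {n} (f : Fin n → Fin n) → Injective _≡_ _≡_ f → ∀ y → ∃ λ x → f x ≡ y
injective⇒surjective {suc m} f f-inj y with any? (λ x → f x ≟ᶠ y)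
... | yes hit  = hit
... | no  miss = contradiction (injective⇒≤ punched-injective) 1+n≰n
  where
  punched : Fin (suc m) → Fin m
  punched x = punchOut {i = y} (λ y≡fx → miss (x , sym y≡fx))
  punched-injective : Injective _≡_ _≡_ punched
  punched-injective eq = f-inj (punchOut-injective {i = y} _ _ eq)

pos-injective : ∀ {n} (τ : Order n) {x y} → pos τ x ≡ pos τ y → x ≡ y
pos-injective τ {x} {y} eq = begin
  x                        ≡⟨ inverseʳ τ {x} ⟨
  τ ⟨$⟩ʳ (τ ⟨$⟩ˡ x)        ≡⟨ cong (τ ⟨$⟩ʳ_) (toℕ-injective eq) ⟩
  τ ⟨$⟩ʳ (τ ⟨$⟩ˡ y)        ≡⟨ inverseʳ τ {y} ⟩
  y                        ∎
  where open ≡-Reasoning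

pos<n : ∀ {n} (τ : Order n) x → pos τ x < n
pos<n τ x = toℕ<n (τ ⟨$⟩ˡ x)

pos-⟨$⟩ʳ : ∀ {n} (τ : Order n) i → pos τ (τ ⟨$⟩ʳ i) ≡ toℕ i
pos-⟨$⟩ʳ τ i = cong toℕ (inverseˡ τ)

pos-≤∧≮⇒≡ : ∀ {n} (τ : Order n) {x y} → pos τ x ≤ pos τ y → ¬ pos τ x < pos τ y → x ≡ y
pos-≤∧≮⇒≡ τ x≤y x≮y = pos-injective τ (≤-antisym x≤y (≮⇒≥ x≮y))

module _ {n : ℕ} (key : Fin n → ℕ) where
  private
    code : Fin n → ℕ
    code x = key x * n + toℕ x

    key<⇒code< : ∀ {x y} → key x < key y → code x < code y
    key<⇒code< {x} {y} kx<ky = begin-strict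
      key x * n + toℕ x   <⟨ +-monoʳ-< (key x * n) (toℕ<n x) ⟩
      key x * n + n       ≡⟨ +-comm (key x * n) n ⟩
      suc (key x) * n     ≤⟨ *-monoˡ-≤ n kx<ky ⟩
      key y * n           ≤⟨ m≤m+n _ _ ⟩
      code y              ∎
      where open ≤-Reasoning

    code-injective : Injective _≡_ _≡_ code
    code-injective {x} {y} eq with <-cmp (key x) (key y)
    ... | tri< kx<ky _ _ = contradiction eq (<⇒≢ (key<⇒code< kx<ky))
    ... | tri> _ _ ky<kx = contradiction (sym eq) (<⇒≢ (key<⇒code< ky<kx))
    ... | tri≈ _ kx≡ky _ =
      toℕ-injective (+-cancelˡ-≡ (key x * n) _ _ (trans eq (cong (λ k → k * n + toℕ y) (sym kx≡ky))))

    rank : Fin n → ℕ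
    rank x = count (λ y → code y <ᵇ code x)

    code<⇒rank< : ∀ {x y} → code x < code y → rank x < rank y
    code<⇒rank< {x} cx<cy = count-< x (λ z cz<cx → <ᵇ-intro (<-trans (<ᵇ-elim cz<cx) cx<cy))
                                     (<ᵇ-irrefl (code x)) (<ᵇ-intro cx<cy)

    rank<n : ∀ x → rank x < n
    rank<n x = <-≤-trans (count-< x (λ _ _ → refl) (<ᵇ-irrefl (code x)) refl) (count≤n _)

    rank-injective : Injective _≡_ _≡_ rank
    rank-injective {x} {y} eq with <-cmp (code x) (code y)
    ... | tri< cx<cy _ _ = contradiction eq (<⇒≢ (code<⇒rank< cx<cy))
    ... | tri≈ _ cx≡cy _ = code-injective cx≡cy
    ... | tri> _ _ cy<cx = contradiction (sym eq) (<⇒≢ (code<⇒rank< cy<cx))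

    rankᶠ : Fin n → Fin n
    rankᶠ x = fromℕ< (rank<n x)

    rankᶠ-injective : Injective _≡_ _≡_ rankᶠ
    rankᶠ-injective {x} {y} eq =
      rank-injective (trans (sym (toℕ-fromℕ< (rank<n x))) (trans (cong toℕ eq) (toℕ-fromℕ< (rank<n y))))

    unrank : Fin n → Fin n
    unrank i = proj₁ (injective⇒surjective rankᶠ rankᶠ-injective i)

    rank-unrank : ∀ i → rankᶠ (unrank i) ≡ i
    rank-unrank i = proj₂ (injective⇒surjective rankᶠ rankᶠ-injective i)

  sortBy : Σ (Order n) λ τ → ∀ x y → pos τ x ≤ pos τ y → key x ≤ key y
  sortBy = τ , sorted
    where
    τ : Order n
    τ = permutation unrank rankᶠ (λ x → rankᶠ-injective (rank-unrank (rankᶠ x))) rank-unrank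
    pos-τ : ∀ x → pos τ x ≡ rank x
    pos-τ x = toℕ-fromℕ< (rank<n x)
    sorted : ∀ x y → pos τ x ≤ pos τ y → key x ≤ key y
    sorted x y px≤py = ≮⇒≥ λ ky<kx →
      <⇒≱ (subst₂ _<_ (sym (pos-τ y)) (sym (pos-τ x)) (code<⇒rank< (key<⇒code< ky<kx))) px≤py

arc-total : ∀ {n} (D : Tournament n) {u v} → u ≢ v → arc D u v ≡ true ⊎ arc D v u ≡ true
arc-total D {u} {v} u≢v with arc D u v in uv
... | true  = inj₁ refl
... | false = inj₂ (trans (tourn D v u (u≢v ∘ sym)) (cong not uv))

degree-bound : ∀ {n} (D : Tournament n) (W : Fin n → Bool) v →
               count W ≤ suc (count (λ w → arc D v w ∧ W w) + count (λ w → arc D w v ∧ W w))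
degree-bound D W v = ≤-trans (count-except v neighbour) (s≤s (count-∨ out-arc in-arc))
  where
  out-arc in-arc : Fin _ → Bool
  out-arc w = arc D v w ∧ W w
  in-arc  w = arc D w v ∧ W w
  neighbour : ∀ w → W w ≡ true → w ≢ v → out-arc w ∨ in-arc w ≡ true
  neighbour w Ww w≢v =
    ∨-intro (Sum.map (λ vw → ∧-intro vw Ww) (λ wv → ∧-intro wv Ww) (arc-total D (w≢v ∘ sym)))

inI-intro : ∀ {n} {σ : Order n} {a b v} → InI σ a b v → inIᵇ σ a b v ≡ true
inI-intro (a≤v , v≤b) = ∧-intro (≤ᵇ-intro a≤v) (≤ᵇ-intro v≤b)

inI-elim : ∀ {n} {σ : Order n} {a b v} → inIᵇ σ a b v ≡ true → InI σ a b v
inI-elim {σ = σ} {a} {v = v} v∈I =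
  let a≤v , v≤b = ∧-elim {toℕ a ≤ᵇ pos σ v} v∈I in ≤ᵇ-elim a≤v , ≤ᵇ-elim v≤b

interval-size : ∀ {n} (σ : Order n) {a b : Fin n} → toℕ a ≤ toℕ b → toℕ b ∸ toℕ a + 1 ≤ count (inIᵇ σ a b)
interval-size {n} σ {a} {b} a≤b =
  subst (_≤ count (inIᵇ σ a b)) (+-comm 1 (toℕ b ∸ toℕ a))
        (count-injection (inIᵇ σ a b) at at-injective (λ i → inI-intro {σ = σ} (at∈I i)))
  where
  offset≤b : (i : Fin (suc (toℕ b ∸ toℕ a))) → toℕ a + toℕ i ≤ toℕ b
  offset≤b i = ≤-trans (+-monoʳ-≤ (toℕ a) (toℕ≤pred[n] i)) (≤-reflexive (m+[n∸m]≡n a≤b))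
  at : Fin (suc (toℕ b ∸ toℕ a)) → Fin n
  at i = σ ⟨$⟩ʳ fromℕ< (≤-<-trans (offset≤b i) (toℕ<n b))
  pos-at : ∀ i → pos σ (at i) ≡ toℕ a + toℕ i
  pos-at i = trans (pos-⟨$⟩ʳ σ _) (toℕ-fromℕ< _)
  at-injective : Injective _≡_ _≡_ at
  at-injective {i} {j} eq =
    toℕ-injective (+-cancelˡ-≡ (toℕ a) _ _ (trans (sym (pos-at i)) (trans (cong (pos σ) eq) (pos-at j))))
  at∈I : ∀ i → InI σ a b (at i)
  at∈I i = subst (toℕ a ≤_) (sym (pos-at i)) (m≤m+n _ _) , subst (_≤ toℕ b) (sym (pos-at i)) (offset≤b i)

module Charging {n : ℕ} (D : Tournament n) (term : Fin n → Bool) where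

  affected-intro : ∀ (τ : Order n) {u v} t → arc D u v ≡ true → pos τ v < pos τ u →
                   term t ≡ true → pos τ v ≤ pos τ t → pos τ t ≤ pos τ u →
                   affectedᵇ D term τ u v ≡ true
  affected-intro τ t uv v<u tt v≤t t≤u =
    ∧-intro uv (∧-intro (<ᵇ-intro v<u)
                        (anyF-intro _ t (∧-intro tt (∧-intro (≤ᵇ-intro v≤t) (≤ᵇ-intro t≤u)))))

  affected-elim : ∀ (τ : Order n) {u v} → affectedᵇ D term τ u v ≡ true →
                  arc D u v ≡ true × pos τ v < pos τ u ×
                  ∃ λ t → term t ≡ true × pos τ v ≤ pos τ t × pos τ t ≤ pos τ u
  affected-elim τ {u} {v} aff with arc D u v | pos τ v <ᵇ pos τ u in v<u | aff
  ... | true | true | spanned =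
    let t , t-spanned = anyF-elim _ spanned
        tt , v≤t∧t≤u = ∧-elim {term t} t-spanned
        v≤t , t≤u = ∧-elim {pos τ v ≤ᵇ pos τ t} v≤t∧t≤u
    in refl , <ᵇ-elim v<u , t , tt , ≤ᵇ-elim v≤t , ≤ᵇ-elim t≤u

  into-terminal : ∀ (τ : Order n) {t u} → term t ≡ true → arc D u t ≡ true → pos τ t < pos τ u →
                  affectedᵇ D term τ u t ≡ true
  into-terminal τ tt ut t<u = affected-intro τ _ ut t<u tt ≤-refl (<⇒≤ t<u)

  from-terminal : ∀ (τ : Order n) {t u} → term t ≡ true → arc D t u ≡ true → pos τ u < pos τ t →
                  affectedᵇ D term τ t u ≡ true
  from-terminal τ tt tu u<t = affected-intro τ _ tu u<t tt (<⇒≤ u<t) ≤-refl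

  path-from-terminal : ∀ (τ : Order n) {t w v} → term t ≡ true → arc D t w ≡ true → arc D w v ≡ true →
                       pos τ v < pos τ t →
                       affectedᵇ D term τ t w ≡ true ⊎ affectedᵇ D term τ w v ≡ true
  path-from-terminal τ {t} {w} tt tw wv v<t with pos τ w <? pos τ t
  ... | yes w<t = inj₁ (from-terminal τ tt tw w<t)
  ... | no  w≮t = inj₂ (affected-intro τ t wv (<-≤-trans v<t (≮⇒≥ w≮t)) tt (<⇒≤ v<t) (≮⇒≥ w≮t))

  path-into-terminal : ∀ (τ : Order n) {t w v} → term t ≡ true → arc D v w ≡ true → arc D w t ≡ true →
                       pos τ t < pos τ v →
                       affectedᵇ D term τ v w ≡ true ⊎ affectedᵇ D term τ w t ≡ true
  path-into-terminal τ {t} {w} tt vw wt t<v with pos τ t <? pos τ w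
  ... | yes t<w = inj₂ (into-terminal τ tt wt t<w)
  ... | no  t≮w = inj₁ (affected-intro τ t vw (≤-<-trans (≮⇒≥ t≮w) t<v) tt (≮⇒≥ t≮w) (<⇒≤ t<v))

  in-arcs-over-terminal : ∀ (τ : Order n) {t v} {W : Fin n → Bool} → term t ≡ true → pos τ v ≤ pos τ t →
                          (∀ w → W w ≡ true → pos τ t < pos τ w) →
                          count (λ w → arc D w v ∧ W w) ≤ cost D term τ
  in-arcs-over-terminal τ {t} {v} tt v≤t after = ≤-trans (count-mono charge) (col≤count₂ _ v)
    where
    charge : ∀ w → arc D w v ∧ _ ≡ true → affectedᵇ D term τ w v ≡ true
    charge w wv∧Ww = let wv , Ww = ∧-elim {arc D w v} wv∧Ww; t<w = after w Ww in
      affected-intro τ t wv (≤-<-trans v≤t t<w) tt v≤t (<⇒≤ t<w)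

  out-arcs-over-terminal : ∀ (τ : Order n) {t v} {W : Fin n → Bool} → term t ≡ true → pos τ t ≤ pos τ v →
                           (∀ w → W w ≡ true → pos τ w < pos τ t) →
                           count (λ w → arc D v w ∧ W w) ≤ cost D term τ
  out-arcs-over-terminal τ {t} {v} tt t≤v before = ≤-trans (count-mono charge) (row≤count₂ _ v)
    where
    charge : ∀ w → arc D v w ∧ _ ≡ true → affectedᵇ D term τ v w ≡ true
    charge w vw∧Ww = let vw , Ww = ∧-elim {arc D v w} vw∧Ww; w<t = before w Ww in
      affected-intro τ t vw (<-≤-trans w<t t≤v) tt (<⇒≤ w<t) t≤v

  in-arcs-bound : ∀ (σ σ* : Order n) {t v} {W : Fin n → Bool} → term t ≡ true →
                  (∀ w → W w ≡ true → pos σ t < pos σ w) → pos σ* v < pos σ* t →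
                  count (λ w → arc D w v ∧ W w) ≤ cost D term σ + (cost D term σ* + cost D term σ*)
  in-arcs-bound σ σ* {t} {v} tt after v<t =
    ≤-trans (count-cover₃ charge) (+-mono-≤ (col≤count₂ _ t) (+-mono-≤ (row≤count₂ _ t) (col≤count₂ _ v)))
    where
    charge : ∀ w → arc D w v ∧ _ ≡ true →
             affectedᵇ D term σ w t ≡ true ⊎ affectedᵇ D term σ* t w ≡ true ⊎ affectedᵇ D term σ* w v ≡ true
    charge w wv∧Ww with ∧-elim {arc D w v} wv∧Ww
    ... | wv , Ww with arc-total D {w} {t} (<⇒≢ (after w Ww) ∘ cong (pos σ) ∘ sym)
    ... | inj₁ wt = inj₁ (into-terminal σ tt wt (after w Ww))
    ... | inj₂ tw = inj₂ (path-from-terminal σ* tt tw wv v<t)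

  out-arcs-bound : ∀ (σ σ* : Order n) {t v} {W : Fin n → Bool} → term t ≡ true →
                   (∀ w → W w ≡ true → pos σ w < pos σ t) → pos σ* t < pos σ* v →
                   count (λ w → arc D v w ∧ W w) ≤ cost D term σ + (cost D term σ* + cost D term σ*)
  out-arcs-bound σ σ* {t} {v} tt before t<v =
    ≤-trans (count-cover₃ charge) (+-mono-≤ (row≤count₂ _ t) (+-mono-≤ (row≤count₂ _ v) (col≤count₂ _ t)))
    where
    charge : ∀ w → arc D v w ∧ _ ≡ true →
             affectedᵇ D term σ t w ≡ true ⊎ affectedᵇ D term σ* v w ≡ true ⊎ affectedᵇ D term σ* w t ≡ true
    charge w vw∧Ww with ∧-elim {arc D v w} vw∧Ww
    ... | vw , Ww with arc-total D {t} {w} (<⇒≢ (before w Ww) ∘ cong (pos σ) ∘ sym)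
    ... | inj₁ tw = inj₁ (from-terminal σ tt tw (before w Ww))
    ... | inj₂ wt = inj₂ (path-into-terminal σ* tt vw wt t<v)

module Reachability {n : ℕ} (E : Fin n → Fin n → Bool) where

  Reach : ℕ → Fin n → Fin n → Bool
  Reach zero    a b = does (a ≟ᶠ b)
  Reach (suc m) a b = Reach m a b ∨ anyF (λ c → E a c ∧ Reach m c b)

  Reach-refl : ∀ a → Reach 0 a a ≡ true
  Reach-refl a = dec-true (a ≟ᶠ a) refl

  Reach-mono : ∀ {m m′ a b} → m ≤ m′ → Reach m a b ≡ true → Reach m′ a b ≡ true
  Reach-mono = go ∘ ≤⇒≤′
    where
    go : ∀ {m m′ a b} → m ≤′ m′ → Reach m a b ≡ true → Reach m′ a b ≡ true
    go ≤′-refl         r = r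
    go (≤′-step m≤′m′) r = ∨-intro (inj₁ (go m≤′m′ r))

  Reach-snoc : ∀ m {a u v} → Reach m a u ≡ true → E u v ≡ true → Reach (suc m) a v ≡ true
  Reach-snoc zero {a} {u} {v} r uv with ≟ᶠ-elim {x = a} {u} r
  ... | refl = ∨-intro (inj₂ (anyF-intro _ v (∧-intro uv (Reach-refl v))))
  Reach-snoc (suc m) {a} {u} {v} r uv with ∨-elim {Reach m a u} r
  ... | inj₁ r′  = ∨-intro (inj₁ (Reach-snoc m r′ uv))
  ... | inj₂ via =
    let c , ac∧cu = anyF-elim _ via
        ac , cu   = ∧-elim {E a c} ac∧cu
    in ∨-intro (inj₂ (anyF-intro _ c (∧-intro ac (Reach-snoc m cu uv))))

  Dist : ℕ → Fin n → Fin n → Set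
  Dist j a b = Reach j a b ≡ true × (∀ i → i < j → Reach i a b ≢ true)

  Dist-unique : ∀ {j j′ a b} → Dist j a b → Dist j′ a b → j ≡ j′
  Dist-unique {j} {j′} (r , shortest) (r′ , shortest′) with <-cmp j j′
  ... | tri< j<j′ _ _ = contradiction r (shortest′ j j<j′)
  ... | tri≈ _ j≡j′ _ = j≡j′
  ... | tri> _ _ j′<j = contradiction r′ (shortest j′ j′<j)

  Reach⇒Dist : ∀ m {a b} → Reach m a b ≡ true → ∃ λ j → Dist j a b
  Reach⇒Dist zero    r = 0 , r , λ _ ()
  Reach⇒Dist (suc m) {a} {b} r with Reach m a b in r′
  ... | true  = Reach⇒Dist m r′
  ... | false = suc m , ∨-intro {Reach m a b} (inj₂ r) , λ i i<1+m → not-¬ r′ ∘ Reach-mono (≤-pred i<1+m)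

  -- A shortest walk: its i-th vertex is at distance j ∸ i from b, so its vertices are distinct.
  record Geodesic (j : ℕ) (a b : Fin n) : Set where
    field
      vertex : Fin (suc j) → Fin n
      first  : vertex zero ≡ a
      last   : vertex (fromℕ j) ≡ b
      link   : ∀ (i : Fin j) → E (vertex (inject₁ i)) (vertex (suc i)) ≡ true
      dist   : ∀ i → Dist (j ∸ toℕ i) (vertex i) b

    injective : ∀ i i′ → vertex i ≡ vertex i′ → i ≡ i′
    injective i i′ eq = toℕ-injective (begin
      toℕ i             ≡⟨ m∸[m∸n]≡n (toℕ≤pred[n] i) ⟨
      j ∸ (j ∸ toℕ i)   ≡⟨ cong (j ∸_) (Dist-unique (subst (λ w → Dist _ w b) eq (dist i)) (dist i′)) ⟩
      j ∸ (j ∸ toℕ i′)  ≡⟨ m∸[m∸n]≡n (toℕ≤pred[n] i′) ⟩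
      toℕ i′            ∎)
      where open ≡-Reasoning

  geodesic : ∀ {j a b} → Dist j a b → Geodesic j a b
  geodesic {zero} {a} d@(r , _) = record
    { vertex = λ _ → a ; first = refl ; last = ≟ᶠ-elim r ; link = λ () ; dist = λ { zero → d } }
  geodesic {suc j} {a} {b} d@(r , shortest) with ∨-elim {Reach j a b} r
  ... | inj₁ rⱼ  = contradiction rⱼ (shortest j ≤-refl)
  ... | inj₂ via =
    let c , ac∧cb = anyF-elim _ via
        ac , cb   = ∧-elim {E a c} ac∧cb
        rest      = geodesic {j} (cb , λ i i<j rᵢ →
                      shortest (suc i) (s≤s i<j) (∨-intro (inj₂ (anyF-intro _ c (∧-intro ac rᵢ)))))
        open Geodesic rest
    in record
      { vertex = λ { zero → a ; (suc i) → vertex i }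
      ; first  = refl
      ; last   = last
      ; link   = λ { zero → subst (λ w → E a w ≡ true) (sym first) ac ; (suc i) → link i }
      ; dist   = λ { zero → d ; (suc i) → dist i }
      }

  Reach-bounded : ∀ m {a b} → Reach m a b ≡ true → Reach n a b ≡ true
  Reach-bounded m r =
    let j , d = Reach⇒Dist m r
        open Geodesic (geodesic d)
    in Reach-mono (≤-trans (n≤1+n j) (injective⇒≤ (injective _ _))) (proj₁ d)

  close-cycle : ∀ m {u v} → Reach m v u ≡ true → E u v ≡ true → Σ (DirCycle E) λ C → vtx C zero ≡ v
  close-cycle m r uv =
    let j , d = Reach⇒Dist m r
        open Geodesic (geodesic d)
    in record { len = j ; vtx = vertex ; inj = injective ; step = link
              ; close = subst₂ (λ x y → E x y ≡ true) (sym last) (sym first) uv }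
       , first

module CycleHitting {n : ℕ} (D : Tournament n) (term : Fin n → Bool) (S : Fin n → Fin n → Bool)
  (hits : ∀ (C : DirCycle (λ u v → arc D u v ∧ not (S u v))) i → term (vtx C i) ≡ false) where

  E : Fin n → Fin n → Bool
  E u v = arc D u v ∧ not (S u v)

  open Reachability E

  reachingTerminals : Fin n → ℕ
  reachingTerminals x = count (λ t → term t ∧ Reach n t x)

  no-cycle-through-terminal : ∀ {m u v} → term v ≡ true → E u v ≡ true → Reach m v u ≢ true
  no-cycle-through-terminal {m} tv uv vu =
    let C , C₀≡v = close-cycle m vu uv in
    not-¬ (subst (λ x → term x ≡ false) C₀≡v (hits C zero)) tv

  reach-along : ∀ {t u v} → E u v ≡ true → term t ∧ Reach n t u ≡ true → term t ∧ Reach n t v ≡ true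
  reach-along {t} uv tt∧tu =
    let tt , tu = ∧-elim {term t} tt∧tu in ∧-intro tt (Reach-bounded (suc n) (Reach-snoc n tu uv))

  reachingTerminals-mono : ∀ {u v} → E u v ≡ true → reachingTerminals u ≤ reachingTerminals v
  reachingTerminals-mono uv = count-mono (λ t → reach-along {t} uv)

  reachingTerminals-< : ∀ {u v} → E u v ≡ true → term v ≡ true → reachingTerminals u < reachingTerminals v
  reachingTerminals-< {v = v} uv tv =
    count-< v (λ t → reach-along {t} uv) (no-cycle-through-terminal {n} tv uv ∘ proj₂ ∘ ∧-elim {term v})
              (∧-intro tv (Reach-mono {m′ = n} z≤n (Reach-refl v)))

  -- Terminals get even levels and the other vertices odd ones; arcs of D - S never decrease
  -- the level, and strictly increase it when they leave a terminal.
  level : Fin n → ℕ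
  level x = if term x then 2 * reachingTerminals x else suc (2 * reachingTerminals x)

  level-terminal : ∀ {x} → term x ≡ true → level x ≡ 2 * reachingTerminals x
  level-terminal tx rewrite tx = refl

  level-nonterminal : ∀ {x} → term x ≡ false → level x ≡ suc (2 * reachingTerminals x)
  level-nonterminal tx rewrite tx = refl

  level≤odd : ∀ x → level x ≤ suc (2 * reachingTerminals x)
  level≤odd x with term x
  ... | true  = n≤1+n _
  ... | false = ≤-refl

  level-mono : ∀ {u v} → E u v ≡ true → level u ≤ level v
  level-mono {u} {v} uv with term v in tv
  ... | false = ≤-trans (level≤odd u) (s≤s (*-monoʳ-≤ 2 (reachingTerminals-mono uv)))
  ... | true  = begin
    level u                          ≤⟨ level≤odd u ⟩
    suc (2 * reachingTerminals u)    <⟨ n<1+n _ ⟩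
    2 + 2 * reachingTerminals u      ≡⟨ *-suc 2 _ ⟨
    2 * suc (reachingTerminals u)    ≤⟨ *-monoʳ-≤ 2 (reachingTerminals-< uv tv) ⟩
    2 * reachingTerminals v          ∎
    where open ≤-Reasoning

  level-<-from-terminal : ∀ {u v} → E u v ≡ true → term u ≡ true → level u < level v
  level-<-from-terminal {u} {v} uv tu rewrite level-terminal tu with term v in tv
  ... | false = s≤s (*-monoʳ-≤ 2 (reachingTerminals-mono uv))
  ... | true  = *-monoʳ-< 2 (reachingTerminals-< uv tv)

  module _ (τ : Order n) (sorted : ∀ x y → pos τ x ≤ pos τ y → level x ≤ level y) where
    open Charging D term using (affected-elim)

    no-affected-arc : ∀ {u v t} → E u v ≡ true → pos τ v < pos τ u →
                      term t ≡ true → pos τ v ≤ pos τ t → pos τ t ≤ pos τ u → ⊥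
    no-affected-arc {u} {v} {t} uv v<u tt v≤t t≤u with term u in tu
    ... | true  = <⇒≱ (level-<-from-terminal uv tu) (sorted v u (<⇒≤ v<u))
    ... | false = even≢odd (reachingTerminals t) (reachingTerminals u) (begin
      2 * reachingTerminals t        ≡⟨ level-terminal tt ⟨
      level t                        ≡⟨ ≤-antisym (sorted t u t≤u) u≤t ⟩
      level u                        ≡⟨ level-nonterminal tu ⟩
      suc (2 * reachingTerminals u)  ∎)
      where
      open ≡-Reasoning
      u≤t : level u ≤ level t
      u≤t = ≤-trans (level-mono uv) (sorted v t v≤t)

    affected⇒deleted : ∀ u v → affectedᵇ D term τ u v ≡ true → S u v ≡ true
    affected⇒deleted u v aff with S u v in uv∈S
    ... | true  = refl
    ... | false =
      let uv∈D , v<u , t , tt , v≤t , t≤u = affected-elim τ aff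
      in ⊥-elim (no-affected-arc (∧-intro uv∈D (cong not uv∈S)) v<u tt v≤t t≤u)

yes⇒cheapOrder : ∀ {n} (D : Tournament n) (term : Fin n → Bool) k →
                 YesInstance D term k → Σ (Order n) λ τ → cost D term τ ≤ k
yes⇒cheapOrder D term k (S , _ , |S|≤k , hits) =
  let open CycleHitting D term S hits
      τ , sorted = sortBy level
  in τ , ≤-trans (count₂-mono (affected⇒deleted τ sorted)) |S|≤k

module Intervals {n : ℕ} (term : Fin n → Bool) (τ : Order n) where

  interval-nonterminal : ∀ {a b v} → NonTermInterval term τ a b → InI τ a b v → term v ≡ false
  interval-nonterminal (_ , no-terminal) v∈I = ¬-not λ tv → no-terminal _ tv v∈I

  terminal-outside : ∀ {a b t} → NonTermInterval term τ a b → term t ≡ true →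
                     pos τ t < toℕ a ⊎ toℕ b < pos τ t
  terminal-outside {a} {b} {t} (_ , no-terminal) tt with pos τ t <? toℕ a | toℕ b <? pos τ t
  ... | yes t<a | _       = inj₁ t<a
  ... | no _    | yes b<t = inj₂ b<t
  ... | no t≮a  | no b≮t  = contradiction (≮⇒≥ t≮a , ≮⇒≥ b≮t) (no-terminal t tt)

  terminal-before : ∀ {a b v} → MaximalNT term τ a b → pos τ v < toℕ a →
                    ∃ λ t → term t ≡ true × pos τ v ≤ pos τ t × pos τ t < toℕ a
  terminal-before {a} {b} {v} (I@(a≤b , _) , maximal) v<a
    with any? (λ t → (term t ≟ᵇ true) ×-dec (pos τ v ≤? pos τ t) ×-dec (pos τ t <? toℕ a))
  ... | yes found = found
  ... | no  none  = contradiction (cong toℕ (proj₁ (maximal _ b [v,b] (<⇒≤ v<a) ≤-refl))) (<⇒≢ v<a)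
    where
    [v,b] : NonTermInterval term τ (τ ⟨$⟩ˡ v) b
    [v,b] = ≤-trans (<⇒≤ v<a) a≤b , λ t tt (v≤t , t≤b) →
      Sum.[ (λ t<a → none (t , tt , v≤t , t<a)) , (λ b<t → <⇒≱ b<t t≤b) ] (terminal-outside I tt)

  terminal-after : ∀ {a b v} → MaximalNT term τ a b → toℕ b < pos τ v →
                   ∃ λ t → term t ≡ true × toℕ b < pos τ t × pos τ t ≤ pos τ v
  terminal-after {a} {b} {v} (I@(a≤b , _) , maximal) b<v
    with any? (λ t → (term t ≟ᵇ true) ×-dec (toℕ b <? pos τ t) ×-dec (pos τ t ≤? pos τ v))
  ... | yes found = found
  ... | no  none  = contradiction (cong toℕ (proj₂ (maximal a _ [a,v] ≤-refl (<⇒≤ b<v)))) (<⇒≢ b<v ∘ sym)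
    where
    [a,v] : NonTermInterval term τ a (τ ⟨$⟩ˡ v)
    [a,v] = ≤-trans a≤b (<⇒≤ b<v) , λ t tt (a≤t , t≤v) →
      Sum.[ (λ t<a → <⇒≱ t<a a≤t) , (λ b<t → none (t , tt , b<t , t≤v)) ] (terminal-outside I tt)

  module _ (x : Fin n) (tx : term x ≡ false) where
    private
      -- start is one past the last terminal before x (0 if none), stop is the position of the
      -- first terminal after x (n if none).
      leftEnd rightEnd : Fin n → ℕ
      leftEnd  t = if term t ∧ (pos τ t <ᵇ pos τ x) then suc (pos τ t) else 0
      rightEnd t = if term t ∧ (pos τ x <ᵇ pos τ t) then pos τ t else n

      start stop : ℕ
      start = max 0 (tabulate leftEnd)
      stop  = min n (tabulate rightEnd)

      start≤x : start ≤ pos τ x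
      start≤x = max≤v⁺ z≤n (All.tabulate⁺ bound)
        where
        bound : ∀ t → leftEnd t ≤ pos τ x
        bound t with term t ∧ (pos τ t <ᵇ pos τ x) in left
        ... | true  = <ᵇ-elim (proj₂ (∧-elim {term t} left))
        ... | false = z≤n

      x<stop : pos τ x < stop
      x<stop = v≤min⁺ (pos<n τ x) (All.tabulate⁺ bound)
        where
        bound : ∀ t → pos τ x < rightEnd t
        bound t with term t ∧ (pos τ x <ᵇ pos τ t) in right
        ... | true  = <ᵇ-elim (proj₂ (∧-elim {term t} right))
        ... | false = pos<n τ x

      terminal-split : ∀ {t} → term t ≡ true → pos τ t < start ⊎ stop ≤ pos τ t
      terminal-split {t} tt with <-cmp (pos τ t) (pos τ x)
      ... | tri< t<x _ _ = inj₁ (v≤max⁺ 0 _ (inj₂ (Any.tabulate⁺ t (≤-reflexive (sym hit)))))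
        where
        hit : leftEnd t ≡ suc (pos τ t)
        hit = cong (λ c → if c then suc (pos τ t) else 0) (∧-intro tt (<ᵇ-intro t<x))
      ... | tri≈ _ t≡x _ = contradiction tt (not-¬ (trans (cong term (pos-injective τ t≡x)) tx))
      ... | tri> _ _ x<t = inj₂ (min≤v⁺ n _ (inj₂ (Any.tabulate⁺ t (≤-reflexive hit))))
        where
        hit : rightEnd t ≡ pos τ t
        hit = cong (λ c → if c then pos τ t else n) (∧-intro tt (<ᵇ-intro x<t))

      start-attained : 0 < start → ∃ λ t → term t ≡ true × start ≡ suc (pos τ t)
      start-attained 0<start with argmax-sel (λ m → m) 0 (tabulate leftEnd)
      ... | inj₁ start≡0 = contradiction start≡0 (>⇒≢ 0<start)
      ... | inj₂ start∈ with ∈-tabulate⁻ start∈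
      ...   | t , start≡ with term t ∧ (pos τ t <ᵇ pos τ x) in left
      ...     | true  = t , proj₁ (∧-elim {term t} left) , start≡
      ...     | false = contradiction start≡ (>⇒≢ 0<start)

      stop-attained : stop < n → ∃ λ t → term t ≡ true × stop ≡ pos τ t
      stop-attained stop<n with argmin-sel (λ m → m) n (tabulate rightEnd)
      ... | inj₁ stop≡n = contradiction stop≡n (<⇒≢ stop<n)
      ... | inj₂ stop∈ with ∈-tabulate⁻ stop∈
      ...   | t , stop≡ with term t ∧ (pos τ x <ᵇ pos τ t) in right
      ...     | true  = t , proj₁ (∧-elim {term t} right) , stop≡
      ...     | false = contradiction stop≡ (<⇒≢ stop<n)

      end : ℕ
      end = pred stop

      suc-end : suc end ≡ stop
      suc-end = suc-pred stop {{>-nonZero (≤-<-trans z≤n x<stop)}}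

      x≤end : pos τ x ≤ end
      x≤end = <⇒≤pred x<stop

      startᶠ endᶠ : Fin n
      startᶠ = fromℕ< (≤-<-trans start≤x (pos<n τ x))
      endᶠ   = fromℕ< (subst (_≤ n) (sym suc-end) (min≤⊤ n (tabulate rightEnd)))

      startᶠ≡start : toℕ startᶠ ≡ start
      startᶠ≡start = toℕ-fromℕ< _

      endᶠ≡end : toℕ endᶠ ≡ end
      endᶠ≡end = toℕ-fromℕ< _

      x∈I : InI τ startᶠ endᶠ x
      x∈I = subst (_≤ pos τ x) (sym startᶠ≡start) start≤x , subst (pos τ x ≤_) (sym endᶠ≡end) x≤end

      I-nonterminal : NonTermInterval term τ startᶠ endᶠ
      I-nonterminal = subst₂ _≤_ (sym startᶠ≡start) (sym endᶠ≡end) (≤-trans start≤x x≤end) ,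
                      λ t tt (s≤t , t≤e) →
        Sum.[ (λ t<start → <⇒≱ t<start (subst (_≤ pos τ t) startᶠ≡start s≤t))
            , (λ stop≤t → <⇒≱ (subst (_≤ pos τ t) (sym suc-end) stop≤t) (subst (pos τ t ≤_) endᶠ≡end t≤e)) ]
          (terminal-split tt)

      I-maximal : ∀ a b → NonTermInterval term τ a b → toℕ a ≤ toℕ startᶠ → toℕ endᶠ ≤ toℕ b →
                  a ≡ startᶠ × b ≡ endᶠ
      I-maximal a b (_ , no-terminal) a≤s e≤b =
        toℕ-injective (≤-antisym a≤s (≮⇒≥ a≮s)) , toℕ-injective (≤-antisym (≮⇒≥ e≮b) e≤b)
        where
        a≤x : toℕ a ≤ pos τ x
        a≤x = ≤-trans (subst (toℕ a ≤_) startᶠ≡start a≤s) start≤x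
        x≤b : pos τ x ≤ toℕ b
        x≤b = ≤-trans x≤end (subst (_≤ toℕ b) endᶠ≡end e≤b)
        a≮s : ¬ toℕ a < toℕ startᶠ
        a≮s a<s =
          let a<start = subst (toℕ a <_) startᶠ≡start a<s
              t , tt , start≡ = start-attained (≤-<-trans z≤n a<start)
              t<x = <-≤-trans (subst (pos τ t <_) (sym start≡) ≤-refl) start≤x
          in no-terminal t tt (≤-pred (subst (toℕ a <_) start≡ a<start) , ≤-trans (<⇒≤ t<x) x≤b)
        e≮b : ¬ toℕ endᶠ < toℕ b
        e≮b e<b =
          let stop≤b = subst (_≤ toℕ b) suc-end (subst (_< toℕ b) endᶠ≡end e<b)
              t , tt , stop≡ = stop-attained (≤-<-trans stop≤b (toℕ<n b))
          in no-terminal t tt ( ≤-trans a≤x (<⇒≤ (<-≤-trans x<stop (≤-reflexive stop≡)))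
                              , subst (_≤ toℕ b) stop≡ stop≤b)

    maximalNT-around : Σ (Fin n) λ a → Σ (Fin n) λ b → MaximalNT term τ a b × InI τ a b x
    maximalNT-around = startᶠ , endᶠ , (I-nonterminal , I-maximal) , x∈I

open Intervals

rich-witness : ∀ {n} {D : Tournament n} {σ : Order n} {d a b} → 0 < richCount D σ d a b →
               ∃ λ v → InI σ a b v × Rich D σ d a b v
rich-witness {D = D} {σ} {d} {a} {b} 0<rich =
  let v , v∈I∧rich = count-pos⇒witness _ 0<rich
      v∈I , rich   = ∧-elim {inIᵇ σ a b v} v∈I∧rich
      many-out , many-in = ∧-elim {d ≤ᵇ outI D σ a b v} rich
  in v , inI-elim {σ = σ} v∈I , ≤ᵇ-elim many-out , ≤ᵇ-elim many-in

cost-budget : ∀ ρ {k A B} → A ≤ ρ * k → B ≤ k → A + (B + B) < (ρ + 2) * k + 1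
cost-budget ρ {k} {A} {B} A≤ρk B≤k = subst (A + (B + B) <_) (+-comm 1 _) (s≤s (begin
  A + (B + B)        ≤⟨ +-mono-≤ A≤ρk (+-mono-≤ B≤k B≤k) ⟩
  ρ * k + (k + k)    ≡⟨ cong (λ m → ρ * k + (k + m)) (+-identityʳ k) ⟨
  ρ * k + 2 * k      ≡⟨ *-distribʳ-+ k ρ 2 ⟨
  (ρ + 2) * k        ∎))
  where open ≤-Reasoning

module TwoOrders {n : ℕ} (D : Tournament n) (term : Fin n → Bool) (σ σ* : Order n) (d : ℕ)
  (budget : cost D term σ + (cost D term σ* + cost D term σ*) < d)
  (l r : Fin n) (I-maximal : MaximalNT term σ l r) (I-large : 2 * d + 1 ≤ toℕ r ∸ toℕ l + 1) where

  open Charging D term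

  private
    p q : Fin n → ℕ
    p = pos σ
    q = pos σ*

    I : Fin n → Bool
    I = inIᵇ σ l r

    l≤r : toℕ l ≤ toℕ r
    l≤r = proj₁ (proj₁ I-maximal)

    cost-σ≤d : cost D term σ ≤ d
    cost-σ≤d = ≤-trans (m≤m+n _ _) (<⇒≤ budget)

    after-l : ∀ {t} → p t < toℕ l → ∀ w → I w ≡ true → p t < p w
    after-l t<l w w∈I = <-≤-trans t<l (proj₁ (inI-elim {σ = σ} {a = l} {b = r} w∈I))

    before-r : ∀ {t} → toℕ r < p t → ∀ w → I w ≡ true → p w < p t
    before-r r<t w w∈I = ≤-<-trans (proj₂ (inI-elim {σ = σ} {a = l} {b = r} w∈I)) r<t

    I-vertex≢terminal : ∀ {v t} → InI σ l r v → term t ≡ true → v ≢ t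
    I-vertex≢terminal v∈I tt refl = not-¬ (interval-nonterminal term σ (proj₁ I-maximal) v∈I) tt

  degree-large : ∀ v → d + d ≤ outI D σ l r v + inNI D σ l r v
  degree-large v = s≤s⁻¹ (begin
    suc (d + d)                                ≡⟨ cong (λ m → suc (d + m)) (+-identityʳ d) ⟨
    suc (2 * d)                                ≡⟨ +-comm 1 (2 * d) ⟩
    2 * d + 1                                  ≤⟨ I-large ⟩
    toℕ r ∸ toℕ l + 1                          ≤⟨ interval-size σ l≤r ⟩
    count I                                    ≤⟨ degree-bound D I v ⟩
    suc (outI D σ l r v + inNI D σ l r v)      ∎)
    where open ≤-Reasoning

  in-rich⇒after-left-terminals : ∀ {v t} → d ≤ inNI D σ l r v → term t ≡ true → p t < toℕ l → ¬ q v < q t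
  in-rich⇒after-left-terminals many-in tt t<l v<t =
    <⇒≱ budget (≤-trans many-in (in-arcs-bound σ σ* tt (after-l t<l) v<t))

  out-rich⇒before-right-terminals : ∀ {v t} → d ≤ outI D σ l r v → term t ≡ true → toℕ r < p t → ¬ q t < q v
  out-rich⇒before-right-terminals many-out tt r<t t<v =
    <⇒≱ budget (≤-trans many-out (out-arcs-bound σ σ* tt (before-r r<t) t<v))

  in-poor⇒out-rich : ∀ {v} → inNI D σ l r v ≤ d ∸ 1 → d ≤ outI D σ l r v
  in-poor⇒out-rich {v} poor =
    ≮⇒≥ λ out<d → <⇒≱ (+-mono-<-≤ out<d (≤-trans poor (m∸n≤m d 1))) (degree-large v)

  out-poor⇒in-rich : ∀ {v} → outI D σ l r v ≤ d ∸ 1 → d ≤ inNI D σ l r v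
  out-poor⇒in-rich {v} poor =
    ≮⇒≥ λ in<d → <⇒≱ (+-mono-≤-< (≤-trans poor (m∸n≤m d 1)) in<d) (degree-large v)

  left-of-I⇒before-right-terminals : ∀ {v t} → p v < toℕ l → term t ≡ true → toℕ r < p t → ¬ q t < q v
  left-of-I⇒before-right-terminals {v} v<l tt r<t t<v =
    let t₀ , t₀-terminal , v≤t₀ , t₀<l = terminal-before term σ I-maximal v<l
        out≤ = out-arcs-bound σ σ* tt (before-r r<t) t<v
        in≤  = in-arcs-over-terminal σ t₀-terminal v≤t₀ (after-l t₀<l)
    in <⇒≱ (+-mono-<-≤ (≤-<-trans out≤ budget) (≤-trans in≤ cost-σ≤d)) (degree-large v)

  right-of-I⇒after-left-terminals : ∀ {v t} → toℕ r < p v → term t ≡ true → p t < toℕ l → ¬ q v < q t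
  right-of-I⇒after-left-terminals {v} r<v tt t<l v<t =
    let t₀ , t₀-terminal , r<t₀ , t₀≤v = terminal-after term σ I-maximal r<v
        out≤ = out-arcs-over-terminal σ t₀-terminal t₀≤v (before-r r<t₀)
        in≤  = in-arcs-bound σ σ* tt (after-l t<l) v<t
    in <⇒≱ (+-mono-≤-< (≤-trans out≤ cost-σ≤d) (≤-<-trans in≤ budget)) (degree-large v)

  module Around (x : Fin n) (x-rich : Rich D σ d l r x)
                (l′ r′ : Fin n) (I*-maximal : MaximalNT term σ* l′ r′) (x∈I* : InI σ* l′ r′ x) where

    private
      l′≤r′ : toℕ l′ ≤ toℕ r′
      l′≤r′ = proj₁ (proj₁ I*-maximal)

    left-terminals-before-I* : ∀ t → term t ≡ true → p t < toℕ l → q t < toℕ l′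
    left-terminals-before-I* t tt t<l with terminal-outside term σ* (proj₁ I*-maximal) tt
    ... | inj₁ t<l′ = t<l′
    ... | inj₂ r′<t =
      contradiction (≤-<-trans (proj₂ x∈I*) r′<t) (in-rich⇒after-left-terminals (proj₂ x-rich) tt t<l)

    right-terminals-after-I* : ∀ t → term t ≡ true → toℕ r < p t → toℕ r′ < q t
    right-terminals-after-I* t tt r<t with terminal-outside term σ* (proj₁ I*-maximal) tt
    ... | inj₁ t<l′ =
      contradiction (<-≤-trans t<l′ (proj₁ x∈I*)) (out-rich⇒before-right-terminals (proj₁ x-rich) tt r<t)
    ... | inj₂ r′<t = r′<t

    private
      terminal-before-I*-is-left : ∀ {t} → term t ≡ true → q t < toℕ l′ → p t < toℕ l
      terminal-before-I*-is-left {t} tt t<l′ with terminal-outside term σ (proj₁ I-maximal) tt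
      ... | inj₁ t<l = t<l
      ... | inj₂ r<t = contradiction (right-terminals-after-I* t tt r<t) (≤⇒≯ (≤-trans (<⇒≤ t<l′) l′≤r′))

      terminal-after-I*-is-right : ∀ {t} → term t ≡ true → toℕ r′ < q t → toℕ r < p t
      terminal-after-I*-is-right {t} tt r′<t with terminal-outside term σ (proj₁ I-maximal) tt
      ... | inj₁ t<l = contradiction (left-terminals-before-I* t tt t<l) (≤⇒≯ (≤-trans l′≤r′ (<⇒≤ r′<t)))
      ... | inj₂ r<t = r<t

    in-rich-not-before-I* : ∀ {v} → InI σ l r v → d ≤ inNI D σ l r v → ¬ q v < toℕ l′
    in-rich-not-before-I* v∈I many-in v<l′ =
      let t , tt , v≤t , t<l′ = terminal-before term σ* I*-maximal v<l′
      in I-vertex≢terminal v∈I tt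
           (pos-≤∧≮⇒≡ σ* v≤t (in-rich⇒after-left-terminals many-in tt (terminal-before-I*-is-left tt t<l′)))

    out-rich-not-after-I* : ∀ {v} → InI σ l r v → d ≤ outI D σ l r v → ¬ toℕ r′ < q v
    out-rich-not-after-I* v∈I many-out r′<v =
      let t , tt , r′<t , t≤v = terminal-after term σ* I*-maximal r′<v
      in I-vertex≢terminal v∈I tt
           (sym (pos-≤∧≮⇒≡ σ* t≤v
                  (out-rich⇒before-right-terminals many-out tt (terminal-after-I*-is-right tt r′<t))))

    rich⇒in-I* : ∀ v → InI σ l r v → Rich D σ d l r v → InI σ* l′ r′ v
    rich⇒in-I* v v∈I (many-out , many-in) =
      ≮⇒≥ (in-rich-not-before-I* v∈I many-in) , ≮⇒≥ (out-rich-not-after-I* v∈I many-out)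

    left-of-I-not-after-I* : ∀ {v} → p v < toℕ l → ¬ toℕ r′ < q v
    left-of-I-not-after-I* v<l r′<v =
      let t , tt , r′<t , t≤v = terminal-after term σ* I*-maximal r′<v
          r<t = terminal-after-I*-is-right tt r′<t
          t≡v = pos-≤∧≮⇒≡ σ* t≤v (left-of-I⇒before-right-terminals v<l tt r<t)
      in <⇒≱ (subst (λ u → toℕ r < p u) t≡v r<t) (<⇒≤ (<-≤-trans v<l l≤r))

    right-of-I-not-before-I* : ∀ {v} → toℕ r < p v → ¬ q v < toℕ l′
    right-of-I-not-before-I* r<v v<l′ =
      let t , tt , v≤t , t<l′ = terminal-before term σ* I*-maximal v<l′
          t<l = terminal-before-I*-is-left tt t<l′
          v≡t = pos-≤∧≮⇒≡ σ* v≤t (right-of-I⇒after-left-terminals r<v tt t<l)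
      in <⇒≱ (subst (λ u → p u < toℕ l) (sym v≡t) t<l) (<⇒≤ (≤-<-trans l≤r r<v))

lemma8 : ∀ {n : ℕ} (D : Tournament n) (term : Fin n → Bool) (k ρ : ℕ) →
    1 ≤ ρ →
    let d = (ρ + 2) * k + 1 in
    YesInstance D term k →
    (σ : Order n) → Regular D term σ → cost D term σ ≤ ρ * k →
    (l r : Fin n) → MaximalNT term σ l r →
    2 * d + 1 ≤ toℕ r ∸ toℕ l + 1 →
    k + 1 ≤ richCount D σ d l r →
    (σ* : Order n) → Optimal D term σ* →
    Σ (Fin n) λ l' → Σ (Fin n) λ r' →
      MaximalNT term σ* l' r' ×
      -- (a)
      (∀ v → term v ≡ true → pos σ v < toℕ l → pos σ* v < toℕ l') ×
      (∀ v → term v ≡ true → pos σ v > toℕ r → pos σ* v > toℕ r') ×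
      -- (b)
      (∀ v → InI σ l r v → Rich D σ d l r v → InI σ* l' r' v) ×
      -- (c)
      (∀ v → InI σ l r v → OutRich D σ d l r v → ¬ (pos σ* v > toℕ r')) ×
      (∀ v → InI σ l r v → InRich D σ d l r v → ¬ (pos σ* v < toℕ l')) ×
      -- (d)
      (∀ v → pos σ v < toℕ l → ¬ (pos σ* v > toℕ r')) ×
      (∀ v → pos σ v > toℕ r → ¬ (pos σ* v < toℕ l'))
lemma8 D term k ρ _ yes-instance σ _ cost-σ l r I-maximal I-large enough-rich σ* σ*-optimal =
  let x , x∈I , x-rich = rich-witness {D = D} {σ} (≤-trans (m≤n+m 1 k) enough-rich)
      x-nonterminal = interval-nonterminal term σ (proj₁ I-maximal) x∈I
      l′ , r′ , I*-maximal , x∈I* = maximalNT-around term σ* x x-nonterminal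
      open TwoOrders D term σ σ* ((ρ + 2) * k + 1) budget l r I-maximal I-large
      open Around x x-rich l′ r′ I*-maximal x∈I*
  in l′ , r′ , I*-maximal
   , left-terminals-before-I* , right-terminals-after-I*
   , rich⇒in-I*
   , (λ v v∈I few-in → out-rich-not-after-I* v∈I (in-poor⇒out-rich few-in))
   , (λ v v∈I few-out → in-rich-not-before-I* v∈I (out-poor⇒in-rich few-out))
   , (λ v → left-of-I-not-after-I*)
   , (λ v → right-of-I-not-before-I*)
  where
  budget : cost D term σ + (cost D term σ* + cost D term σ*) < (ρ + 2) * k + 1
  budget = let τ , cost-τ = yes⇒cheapOrder D term k yes-instance
           in cost-budget ρ cost-σ (≤-trans (σ*-optimal τ) cost-τ)
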